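{- If $T \in \mathscr{T}_{max}$ has $n = |V(T)| \ge 3$, then there is a leaf $v \in V(T)$ such that $T - v \in \mathscr{T}_{max}$.
   Context: A leaf is a vertex of degree 1. $N(v)$ denotes the open neighborhood of $v$. A set $S \subseteq V(G)$ is a locating-dominating (LD) set if for all $u,v \in V(G)-S$: $N(v)\cap S \neq \varnothing$, and if $u \ne v$ then $N(v) \cap S \neq N(u) \cap S$. A RED:LD set is an LD set $S$ such that $S-\{v\}$ is an LD set for every $v \in S$. $\textrm{RED:LD}(G)$ is the minimum cardinality of a RED:LD set of $G$. $\mathscr{T}_{max}$ is the family of all trees $T$ of order $n \ge 2$ with $\textrm{RED:LD}(T) = n$. -}

module Defs where

open import Data.Nat using (ℕ; zero; suc; _≤_)
open import Data.Fin using (Fin; zero; suc; inject₁; fromℕ; punchIn)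
open import Data.Fin.Subset using (Subset; _∈_; _∉_; _-_; ∣_∣; Nonempty; _∩_; ⁅_⁆; ⊥)
open import Data.Vec using (tabulate)
open import Data.Bool using (Bool; true; false; if_then_else_)
open import Data.Fin.Patterns using ()
open import Data.Product using (Σ; ∃; _×_)
open import Relation.Binary.PropositionalEquality using (_≡_; _≢_)
open import Relation.Nullary using (¬_)
open import Function.Definitions using (Injective)
open import Data.Fin.Subset using (outside; inside) public

record Graph (n : ℕ) : Set where
  field
    adj   : Fin n → Fin n → Bool
    sym   : ∀ u v → adj u v ≡ adj v u
    irrefl : ∀ v → adj v v ≡ false
open Graph public

_∼[_]_ : ∀ {n} → Fin n → Graph n → Fin n → Set
u ∼[ G ] v = adj G u v ≡ true

N : ∀ {n} → Graph n → Fin n → Subset n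
N G v = tabulate λ w → if adj G v w then inside else outside

degree : ∀ {n} → Graph n → Fin n → ℕ
degree G v = ∣ N G v ∣

IsLeaf : ∀ {n} → Graph n → Fin n → Set
IsLeaf G v = degree G v ≡ 1

data Walk {n} (G : Graph n) : Fin n → Fin n → Set where
  here : ∀ {u} → Walk G u u
  step : ∀ {u w v} → u ∼[ G ] w → Walk G w v → Walk G u v

Connected : ∀ {n} → Graph n → Set
Connected G = ∀ u v → Walk G u v

-- a cycle of length k+1 ≥ 3: injective c : Fin (suc k) → Fin n with
-- c i ~ c (i+1) and c k ~ c 0
record Cycle {n} (G : Graph n) : Set where
  field
    k     : ℕ
    len≥3 : 2 ≤ k
    c     : Fin (suc k) → Fin n
    inj   : Injective _≡_ _≡_ c
    edges : ∀ (i : Fin k) → c (inject₁ i) ∼[ G ] c (suc i)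
    close : c (fromℕ k) ∼[ G ] c zero

Acyclic : ∀ {n} → Graph n → Set
Acyclic G = ¬ Cycle G

IsTree : ∀ {n} → Graph n → Set
IsTree G = Connected G × Acyclic G

IsLD : ∀ {n} → Graph n → Subset n → Set
IsLD G S = ∀ u v → u ∉ S → v ∉ S →
  Nonempty (N G v ∩ S) × (u ≢ v → (N G v ∩ S) ≢ (N G u ∩ S))

IsREDLD : ∀ {n} → Graph n → Subset n → Set
IsREDLD G S = IsLD G S × (∀ v → v ∈ S → IsLD G (S - v))

REDLDNumber : ∀ {n} → Graph n → ℕ → Set
REDLDNumber G k = (∃ λ S → IsREDLD G S × ∣ S ∣ ≡ k)
                × (∀ S → IsREDLD G S → k ≤ ∣ S ∣)

InTmax : ∀ {n} → Graph n → Set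
InTmax {n} G = 2 ≤ n × IsTree G × REDLDNumber G n

deleteVertex : ∀ {n} → Graph (suc n) → Fin (suc n) → Graph n
deleteVertex G v = record
  { adj = λ i j → adj G (punchIn v i) (punchIn v j)
  ; sym = λ i j → sym G (punchIn v i) (punchIn v j)
  ; irrefl = λ i → irrefl G (punchIn v i)
  }

{-# OPTIONS --safe #-}
module Submission where

-- Call distinct vertices x and w inseparable when N(x) ⊆ {w}, N(w) ⊆ {x}, or N(x) and N(w)
-- agree outside {x, w}: no locating-dominating set omits both. In a graph without isolated
-- vertices, RED:LD(G) = n exactly when every vertex has an inseparable partner: if x ∉ S had a
-- partner w, then S (when w ∉ S) or S - w (when w ∈ S) would be an LD set omitting both, while a
-- vertex x without a partner makes V - x a RED:LD set.
-- In a tree with at least three vertices, the penultimate vertex s of a longest path has a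
-- neighbour t and at least one other neighbour, and all its neighbours except t are leaves.
-- Delete such a leaf v. In T - v every vertex still has a partner: partners other than v
-- survive, a vertex whose partner was v has the same neighbours as v and is therefore
-- partnered by s, and s itself is partnered by another leaf at s or, if there is none, by t.

open import Defs hiding (sym)
open import Data.Bool using (true; false; if_then_else_)
import Data.Bool as Bool
open import Data.Bool.Properties using (¬-not)
open import Data.Empty using (⊥; ⊥-elim)
open import Data.Fin using (Fin; zero; suc; _≟_; toℕ; punchIn; punchOut)
open import Data.Fin.Properties
  using (any?; all?; ¬∀⟶∃¬; toℕ-injective; toℕ<n; toℕ≤pred[n]; toℕ-inject₁; toℕ-fromℕ; injective⇒≤;
         punchIn-injective; punchInᵢ≢i; punchIn-punchOut)
open import Data.Fin.Subset using (Subset; _∈_; _∉_; _-_; ∣_∣; Nonempty; _∩_; ⊤; ⁅_⁆)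
open import Data.Fin.Subset.Properties
  using (_∈?_; ∈⊤; ⊆⊤; ⊆-antisym; ∣⊤∣≡n; x∈p∩q⁺; x∈p∩q⁻; x∈p∧x≢y⇒x∈p-y; p─q⊆p; x∈p⇒∣p-x∣<∣p∣;
         x∈⁅x⁆; x∈⁅y⁆⇒x≡y; ∣⁅x⁆∣≡1)
open import Data.Nat using (ℕ; zero; suc; _+_; _∸_; _≤_; _<_; z≤n; s≤s; s≤s⁻¹; _≤?_)
open import Data.Nat.Properties
  using (≤-refl; ≤-trans; ≤-reflexive; <⇒≤; <⇒≱; n≤1+n; ≤∧≢⇒<; 1+n≰n; +-identityʳ; +-suc; +-cancelˡ-≡;
         +-monoʳ-≤; +-monoʳ-<; m+[n∸m]≡n; m+n∸n≡m; ∸-monoˡ-≤; m≤n⇒m<n∨m≡n; anyUpTo?)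
open import Data.Product using (∃; ∃₂; _×_; _,_; proj₁; proj₂)
open import Data.Sum using (_⊎_; inj₁; inj₂)
open import Data.Vec using (_∷_; lookup; there)
open import Data.Vec.Properties using (lookup∘tabulate; lookup⇒[]=; []=⇒lookup)
open import Function using (_∘_)
open import Relation.Binary.PropositionalEquality
open import Relation.Nullary using (¬_; Dec; yes; no; contradiction)
open import Relation.Nullary.Decidable using (¬?; _×-dec_; _⊎-dec_; _→-dec_)

private
  variable
    n : ℕ

∼-sym : (G : Graph n) {x y : Fin n} → x ∼[ G ] y → y ∼[ G ] x
∼-sym G {x} {y} x∼y = trans (Graph.sym G y x) x∼y

∼⇒≢ : (G : Graph n) {x y : Fin n} → x ∼[ G ] y → x ≢ y
∼⇒≢ G {x} x∼y refl with trans (sym x∼y) (irrefl G x)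
... | ()

lookup-N : (G : Graph n) (x y : Fin n) → lookup (N G x) y ≡ adj G x y
lookup-N G x y rewrite lookup∘tabulate (λ w → if adj G x w then inside else outside) y with adj G x y
... | true  = refl
... | false = refl

∈N⁺ : (G : Graph n) {x y : Fin n} → x ∼[ G ] y → y ∈ N G x
∈N⁺ G {x} {y} x∼y = lookup⇒[]= y (N G x) (trans (lookup-N G x y) x∼y)

∈N⁻ : (G : Graph n) {x y : Fin n} → y ∈ N G x → x ∼[ G ] y
∈N⁻ G {x} {y} y∈N = trans (sym (lookup-N G x y)) ([]=⇒lookup y∈N)

x∉p-x : (p : Subset n) (x : Fin n) → x ∉ p - x
x∉p-x (_ ∷ p) zero    ()
x∉p-x (_ ∷ p) (suc x) (there x∈) = x∉p-x p x x∈

y∉⊤-x⇒y≡x : {x y : Fin n} → y ∉ ⊤ - x → y ≡ x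
y∉⊤-x⇒y≡x {x = x} {y} y∉ with y ≟ x
... | yes y≡x = y≡x
... | no y≢x  = contradiction (x∈p∧x≢y⇒x∈p-y ∈⊤ y≢x) y∉

-- Inseparable pairs and RED:LD(G) = n

NoIsolated : Graph n → Set
NoIsolated G = ∀ x → ∃ λ y → x ∼[ G ] y

NoNeighbourBut : Graph n → Fin n → Fin n → Set
NoNeighbourBut G x w = ∀ y → y ≢ w → adj G x y ≡ false

SameNeighboursBesides : Graph n → Fin n → Fin n → Set
SameNeighboursBesides G x w = ∀ y → y ≢ x → y ≢ w → adj G x y ≡ adj G w y

-- Two distinct vertices that no locating-dominating set can leave both out.
Inseparable : Graph n → Fin n → Fin n → Set
Inseparable G x w =
  x ≢ w × (NoNeighbourBut G x w ⊎ NoNeighbourBut G w x ⊎ SameNeighboursBesides G x w)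

AllInseparable : Graph n → Set
AllInseparable G = ∀ x → ∃ (Inseparable G x)

module _ (G : Graph n) where

  dominated : ∀ {x y S} → x ∼[ G ] y → y ∈ S → Nonempty (N G x ∩ S)
  dominated x∼y y∈S = _ , x∈p∩q⁺ (∈N⁺ G x∼y , y∈S)

  separated : ∀ {x w y S} → y ∈ S → x ∼[ G ] y → adj G w y ≡ false → N G x ∩ S ≢ N G w ∩ S
  separated {w = w} {y} y∈S x∼y w≁y eq
    with trans (sym (∈N⁻ G (proj₁ (x∈p∩q⁻ _ _ (subst (y ∈_) eq (x∈p∩q⁺ (∈N⁺ G x∼y , y∈S))))))) w≁y
  ... | ()

  separated′ : ∀ {x w y S} → y ∈ S → adj G x y ≢ adj G w y → N G x ∩ S ≢ N G w ∩ S
  separated′ {x} {w} {y} y∈S x≁w with adj G x y in x∼y | adj G w y in w∼y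
  ... | true  | false = separated y∈S x∼y w∼y
  ... | false | true  = λ eq → separated y∈S w∼y x∼y (sym eq)
  ... | true  | true  = contradiction refl x≁w
  ... | false | false = contradiction refl x≁w

  noNeighbourBut⇒undominated : ∀ {x w S} → NoNeighbourBut G x w → w ∉ S → ¬ Nonempty (N G x ∩ S)
  noNeighbourBut⇒undominated {x} {w} {S} nb w∉S (y , y∈) with y ≟ w | x∈p∩q⁻ (N G x) S y∈
  ... | yes refl | _ , y∈S = w∉S y∈S
  ... | no y≢w   | y∈N , _ with trans (sym (∈N⁻ G y∈N)) (nb y y≢w)
  ...   | ()

  sameNeighbours⇒sameTrace : ∀ {x w S} → SameNeighboursBesides G x w → x ∉ S → w ∉ S →
                             N G x ∩ S ≡ N G w ∩ S
  sameNeighbours⇒sameTrace {x} {w} {S} same x∉S w∉S =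
    ⊆-antisym (⊆-trace same x∉S w∉S) (⊆-trace (λ y y≢w y≢x → sym (same y y≢x y≢w)) w∉S x∉S)
    where
    ⊆-trace : ∀ {a b} → SameNeighboursBesides G a b → a ∉ S → b ∉ S →
              ∀ {y} → y ∈ N G a ∩ S → y ∈ N G b ∩ S
    ⊆-trace {a} {b} same a∉S b∉S {y} y∈ with x∈p∩q⁻ (N G a) S y∈
    ... | y∈N , y∈S = x∈p∩q⁺ (∈N⁺ G b∼y , y∈S)
      where
      b∼y : b ∼[ G ] y
      b∼y = trans (sym (same y (λ { refl → a∉S y∈S }) λ { refl → b∉S y∈S })) (∈N⁻ G y∈N)

  inseparable⇒notBothOutside : ∀ {S x w} → IsLD G S → Inseparable G x w → x ∉ S → w ∉ S → ⊥
  inseparable⇒notBothOutside ld (_ , inj₁ x⊆w) x∉S w∉S =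
    noNeighbourBut⇒undominated x⊆w w∉S (proj₁ (ld _ _ x∉S x∉S))
  inseparable⇒notBothOutside ld (_ , inj₂ (inj₁ w⊆x)) x∉S w∉S =
    noNeighbourBut⇒undominated w⊆x x∉S (proj₁ (ld _ _ w∉S w∉S))
  inseparable⇒notBothOutside ld (x≢w , inj₂ (inj₂ same)) x∉S w∉S =
    proj₂ (ld _ _ x∉S w∉S) x≢w (sym (sameNeighbours⇒sameTrace same x∉S w∉S))

  -- If x ∉ S has a partner w, then w ∉ S already fails, and w ∈ S fails for S - w.
  allInseparable⇒REDLD-contains : AllInseparable G → ∀ {S} → IsREDLD G S → ∀ x → x ∈ S
  allInseparable⇒REDLD-contains all {S} (ld , red) x with x ∈? S
  ... | yes x∈S = x∈S
  ... | no x∉S with all x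
  ...   | w , insep with w ∈? S
  ...     | no w∉S = ⊥-elim (inseparable⇒notBothOutside ld insep x∉S w∉S)
  ...     | yes w∈S = ⊥-elim (inseparable⇒notBothOutside (red w w∈S) insep
                                 (λ x∈S-w → x∉S (p─q⊆p S ⁅ w ⁆ x∈S-w)) (x∉p-x S w))

  ⊤-x-isLD : NoIsolated G → ∀ x → IsLD G (⊤ - x)
  ⊤-x-isLD nbr x u v u∉ v∉ =
      subst (λ v → Nonempty (N G v ∩ (⊤ - x))) (sym (y∉⊤-x⇒y≡x v∉)) (dominated x∼y (x∈p∧x≢y⇒x∈p-y ∈⊤ y≢x))
    , λ u≢v → contradiction (trans (y∉⊤-x⇒y≡x u∉) (sym (y∉⊤-x⇒y≡x v∉))) u≢v
    where
    x∼y : x ∼[ G ] proj₁ (nbr x)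
    x∼y = proj₂ (nbr x)
    y≢x : proj₁ (nbr x) ≢ x
    y≢x y≡x = ∼⇒≢ G x∼y (sym y≡x)

  ⊤-isREDLD : NoIsolated G → IsREDLD G ⊤
  ⊤-isREDLD nbr = (λ u _ u∉ _ → contradiction ∈⊤ u∉) , λ x _ → ⊤-x-isLD nbr x

  noNeighbourBut? : ∀ x w → Dec (NoNeighbourBut G x w)
  noNeighbourBut? x w = all? λ y → ¬? (y ≟ w) →-dec (adj G x y Bool.≟ false)

  sameNeighboursBesides? : ∀ x w → Dec (SameNeighboursBesides G x w)
  sameNeighboursBesides? x w = all? λ y → ¬? (y ≟ x) →-dec (¬? (y ≟ w) →-dec (adj G x y Bool.≟ adj G w y))

  inseparable? : ∀ x w → Dec (Inseparable G x w)
  inseparable? x w =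
    ¬? (x ≟ w) ×-dec (noNeighbourBut? x w ⊎-dec noNeighbourBut? w x ⊎-dec sameNeighboursBesides? x w)

  ¬noNeighbourBut : ∀ {x w} → ¬ NoNeighbourBut G x w → ∃ λ y → y ≢ w × x ∼[ G ] y
  ¬noNeighbourBut {x} {w} ¬nb with ¬∀⟶∃¬ n _ (λ y → ¬? (y ≟ w) →-dec (adj G x y Bool.≟ false)) ¬nb
  ... | y , ¬imp = y , (λ y≡w → ¬imp λ y≢w → contradiction y≡w y≢w) , ¬-not (λ x≁y → ¬imp λ _ → x≁y)

  ¬sameNeighboursBesides : ∀ {x w} → ¬ SameNeighboursBesides G x w →
                           ∃ λ y → y ≢ x × y ≢ w × adj G x y ≢ adj G w y
  ¬sameNeighboursBesides {x} {w} ¬same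
    with ¬∀⟶∃¬ n _ (λ y → ¬? (y ≟ x) →-dec (¬? (y ≟ w) →-dec (adj G x y Bool.≟ adj G w y))) ¬same
  ... | y , ¬imp = y , (λ y≡x → ¬imp λ y≢x → contradiction y≡x y≢x)
                     , (λ y≡w → ¬imp λ _ y≢w → contradiction y≡w y≢w)
                     , (λ eq → ¬imp λ _ _ → eq)

  ⊤-x-isREDLD : NoIsolated G → ∀ x → (∀ w → ¬ Inseparable G x w) → IsREDLD G (⊤ - x)
  ⊤-x-isREDLD nbr x alone = ⊤-x-isLD nbr x , ⊤-x-w-isLD
    where
    ⊤-x-w-isLD : ∀ w → w ∈ ⊤ - x → IsLD G (⊤ - x - w)
    ⊤-x-w-isLD w w∈ u v u∉ v∉ = dom (y∉⊤-x-w⇒ v∉) , sep (y∉⊤-x-w⇒ u∉) (y∉⊤-x-w⇒ v∉)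
      where
      x≢w : x ≢ w
      x≢w refl = x∉p-x ⊤ x w∈
      S : Subset n
      S = ⊤ - x - w
      ∈S : ∀ {y} → y ≢ x → y ≢ w → y ∈ S
      ∈S y≢x y≢w = x∈p∧x≢y⇒x∈p-y (x∈p∧x≢y⇒x∈p-y ∈⊤ y≢x) y≢w
      y∉⊤-x-w⇒ : ∀ {y} → y ∉ S → y ≡ x ⊎ y ≡ w
      y∉⊤-x-w⇒ {y} y∉ with y ≟ x | y ≟ w
      ... | yes y≡x | _       = inj₁ y≡x
      ... | no _    | yes y≡w = inj₂ y≡w
      ... | no y≢x  | no y≢w  = contradiction (∈S y≢x y≢w) y∉
      notSame : ¬ SameNeighboursBesides G x w
      notSame same = alone w (x≢w , inj₂ (inj₂ same))
      dom : ∀ {v} → v ≡ x ⊎ v ≡ w → Nonempty (N G v ∩ S)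
      dom (inj₁ refl) with ¬noNeighbourBut (λ nb → alone w (x≢w , inj₁ nb))
      ... | y , y≢w , x∼y = dominated x∼y (∈S (λ y≡x → ∼⇒≢ G x∼y (sym y≡x)) y≢w)
      dom (inj₂ refl) with ¬noNeighbourBut (λ nb → alone w (x≢w , inj₂ (inj₁ nb)))
      ... | y , y≢x , w∼y = dominated w∼y (∈S y≢x (λ y≡w → ∼⇒≢ G w∼y (sym y≡w)))
      sep : ∀ {u v} → u ≡ x ⊎ u ≡ w → v ≡ x ⊎ v ≡ w → u ≢ v → N G v ∩ S ≢ N G u ∩ S
      sep (inj₁ refl) (inj₁ refl) u≢v = contradiction refl u≢v
      sep (inj₂ refl) (inj₂ refl) u≢v = contradiction refl u≢v
      sep (inj₁ refl) (inj₂ refl) _ with ¬sameNeighboursBesides notSame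
      ... | y , y≢x , y≢w , differ = separated′ (∈S y≢x y≢w) (λ eq → differ (sym eq))
      sep (inj₂ refl) (inj₁ refl) _ with ¬sameNeighboursBesides notSame
      ... | y , y≢x , y≢w , differ = separated′ (∈S y≢x y≢w) differ

redldNumber⇒allInseparable : (G : Graph (suc n)) → NoIsolated G → REDLDNumber G (suc n) →
                             AllInseparable G
redldNumber⇒allInseparable {n} G nbr (_ , minimal) x with any? (inseparable? G x)
... | yes partner = partner
... | no alone = contradiction ∣⊤∣≤∣⊤-x∣ (<⇒≱ (x∈p⇒∣p-x∣<∣p∣ {p = ⊤} (∈⊤ {x = x})))
  where
  ∣⊤∣≤∣⊤-x∣ : ∣ ⊤ {suc n} ∣ ≤ ∣ ⊤ - x ∣
  ∣⊤∣≤∣⊤-x∣ = subst (_≤ ∣ ⊤ - x ∣) (sym (∣⊤∣≡n (suc n)))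
              (minimal _ (⊤-x-isREDLD G nbr x λ w insep → alone (w , insep)))

allInseparable⇒redldNumber : (G : Graph n) → NoIsolated G → AllInseparable G → REDLDNumber G n
allInseparable⇒redldNumber {n} G nbr all = (⊤ , ⊤-isREDLD G nbr , ∣⊤∣≡n n) , minimal
  where
  minimal : ∀ S → IsREDLD G S → n ≤ ∣ S ∣
  minimal S redld = ≤-reflexive (trans (sym (∣⊤∣≡n n)) (cong ∣_∣ ⊤≡S))
    where
    ⊤≡S : ⊤ ≡ S
    ⊤≡S = ⊆-antisym (λ {x} _ → allInseparable⇒REDLD-contains G all redld x) ⊆⊤

-- Paths and leaf supports in trees

record Path (G : Graph n) (L : ℕ) : Set where
  field
    vertex   : ℕ → Fin n
    edge     : ∀ {i} → i < L → vertex i ∼[ G ] vertex (suc i)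
    distinct : ∀ {i j} → i ≤ L → j ≤ L → vertex i ≡ vertex j → i ≡ j

module _ {G : Graph n} {L : ℕ} (p : Path G L) where
  open Path p

  path-length<order : L < n
  path-length<order = injective⇒≤ {f = λ (a : Fin (suc L)) → vertex (toℕ a)}
    λ {a} {b} eq → toℕ-injective (distinct (toℕ≤pred[n] a) (toℕ≤pred[n] b) eq)

  backEdge⇒cycle : ∀ {i} → 2 + i ≤ L → vertex L ∼[ G ] vertex i → Cycle G
  backEdge⇒cycle {i} 2+i≤L back = record
    { k     = L ∸ i
    ; len≥3 = ≤-trans (≤-reflexive (sym (m+n∸n≡m 2 i))) (∸-monoˡ-≤ i 2+i≤L)
    ; c     = λ a → vertex (i + toℕ a)
    ; inj   = λ {a} {b} eq → toℕ-injective (+-cancelˡ-≡ i _ _ (distinct (within a) (within b) eq))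
    ; edges = λ j → subst₂ (λ a b → vertex a ∼[ G ] vertex b)
                      (cong (i +_) (sym (toℕ-inject₁ j))) (sym (+-suc i (toℕ j)))
                      (edge (≤-trans (+-monoʳ-< i (toℕ<n j)) (≤-reflexive i+[L∸i]≡L)))
    ; close = subst₂ (λ a b → vertex a ∼[ G ] vertex b)
                (sym (trans (cong (i +_) (toℕ-fromℕ (L ∸ i))) i+[L∸i]≡L)) (sym (+-identityʳ i)) back
    }
    where
    i≤L : i ≤ L
    i≤L = ≤-trans (n≤1+n i) (≤-trans (n≤1+n (suc i)) 2+i≤L)
    i+[L∸i]≡L : i + (L ∸ i) ≡ L
    i+[L∸i]≡L = m+[n∸m]≡n i≤L
    within : (a : Fin (suc (L ∸ i))) → i + toℕ a ≤ L
    within a = ≤-trans (+-monoʳ-≤ i (toℕ≤pred[n] a)) (≤-reflexive i+[L∸i]≡L)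

  snoc : Fin n → ℕ → Fin n
  snoc c i with i ≤? L
  ... | yes _ = vertex i
  ... | no  _ = c

  snoc-old : ∀ {c i} → i ≤ L → snoc c i ≡ vertex i
  snoc-old {i = i} i≤L with i ≤? L
  ... | yes _   = refl
  ... | no  i≰L = contradiction i≤L i≰L

  snoc-new : ∀ {c} → snoc c (suc L) ≡ c
  snoc-new with suc L ≤? L
  ... | yes 1+L≤L = contradiction 1+L≤L 1+n≰n
  ... | no  _     = refl

  extend : ∀ {c} → vertex L ∼[ G ] c → (∀ {i} → i ≤ L → vertex i ≢ c) → Path G (suc L)
  extend {c} L∼c fresh = record { vertex = snoc c ; edge = edge′ ; distinct = distinct′ }
    where
    oldOrNew : ∀ {i} → i ≤ suc L → i ≤ L ⊎ i ≡ suc L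
    oldOrNew i≤1+L with m≤n⇒m<n∨m≡n i≤1+L
    ... | inj₁ i<1+L = inj₁ (s≤s⁻¹ i<1+L)
    ... | inj₂ i≡1+L = inj₂ i≡1+L

    edge′ : ∀ {i} → i < suc L → snoc c i ∼[ G ] snoc c (suc i)
    edge′ {i} i<1+L with oldOrNew i<1+L
    ... | inj₁ i<L  = subst₂ (λ a b → a ∼[ G ] b) (sym (snoc-old (<⇒≤ i<L))) (sym (snoc-old i<L)) (edge i<L)
    ... | inj₂ refl = subst₂ (λ a b → a ∼[ G ] b) (sym (snoc-old ≤-refl)) (sym snoc-new) L∼c

    distinct′ : ∀ {i j} → i ≤ suc L → j ≤ suc L → snoc c i ≡ snoc c j → i ≡ j
    distinct′ i≤ j≤ eq with oldOrNew i≤ | oldOrNew j≤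
    ... | inj₁ i≤L  | inj₁ j≤L  = distinct i≤L j≤L (trans (sym (snoc-old i≤L)) (trans eq (snoc-old j≤L)))
    ... | inj₁ i≤L  | inj₂ refl = contradiction (trans (sym (snoc-old i≤L)) (trans eq snoc-new)) (fresh i≤L)
    ... | inj₂ refl | inj₁ j≤L  =
      contradiction (trans (sym (snoc-old j≤L)) (trans (sym eq) snoc-new)) (fresh j≤L)
    ... | inj₂ refl | inj₂ refl = refl

edgePath : (G : Graph n) {a x : Fin n} → x ∼[ G ] a → Path G 1
edgePath {n} G {a} {x} x∼a = record { vertex = vertex ; edge = edge ; distinct = distinct }
  where
  vertex : ℕ → Fin n
  vertex zero    = a
  vertex (suc _) = x
  edge : ∀ {i} → i < 1 → vertex i ∼[ G ] vertex (suc i)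
  edge (s≤s z≤n) = ∼-sym G x∼a
  distinct : ∀ {i j} → i ≤ 1 → j ≤ 1 → vertex i ≡ vertex j → i ≡ j
  distinct {zero}  {zero}  _ _ _ = refl
  distinct {zero}  {suc _} _ (s≤s z≤n) a≡x = contradiction (sym a≡x) (∼⇒≢ G x∼a)
  distinct {suc _} {zero}  (s≤s z≤n) _ x≡a = contradiction x≡a (∼⇒≢ G x∼a)
  distinct {suc _} {suc _} (s≤s z≤n) (s≤s z≤n) _ = refl

Branching : Graph n → Fin n → Set
Branching G x = ∃₂ λ a b → a ≢ b × x ∼[ G ] a × x ∼[ G ] b

LeavesBesides : Graph n → Fin n → Fin n → Set
LeavesBesides G s t = ∀ c → s ∼[ G ] c → c ≢ t → NoNeighbourBut G c s

module _ (G : Graph n) where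

  branching? : ∀ x → Dec (Branching G x)
  branching? x =
    any? λ a → any? λ b → ¬? (a ≟ b) ×-dec ((adj G x a Bool.≟ true) ×-dec (adj G x b Bool.≟ true))

  ¬branching⇒noNeighbourBut : ∀ {x y} → x ∼[ G ] y → ¬ Branching G x → NoNeighbourBut G x y
  ¬branching⇒noNeighbourBut {x} {y} x∼y ¬br z z≢y with adj G x z in x∼z
  ... | false = refl
  ... | true  = contradiction (y , z , (λ y≡z → z≢y (sym y≡z)) , x∼y , x∼z) ¬br

connected⇒noIsolated : (G : Graph (2 + n)) → Connected G → NoIsolated G
connected⇒noIsolated G conn zero with conn zero (suc zero)
... | step 0∼y _ = _ , 0∼y
connected⇒noIsolated G conn (suc x) with conn (suc x) zero
... | step x∼y _ = _ , x∼y

-- Without branching vertices every walk from 0 stays within 0 and its unique neighbour.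
connected⇒branching : (G : Graph (3 + n)) → Connected G → ∃ (Branching G)
connected⇒branching {n} G conn with any? (branching? G)
... | yes br = br
... | no ¬br = noThird (avoiding b)
  where
  avoiding : (b : Fin (3 + n)) → ∃ λ z → z ≢ zero × z ≢ b
  avoiding zero          = suc zero , (λ ()) , (λ ())
  avoiding (suc zero)    = suc (suc zero) , (λ ()) , (λ ())
  avoiding (suc (suc _)) = suc zero , (λ ()) , (λ ())

  b : Fin (3 + n)
  b = proj₁ (connected⇒noIsolated G conn zero)
  0∼b : zero ∼[ G ] b
  0∼b = proj₂ (connected⇒noIsolated G conn zero)

  unique : ∀ {x a c} → x ∼[ G ] a → x ∼[ G ] c → a ≡ c
  unique {x} {a} {c} x∼a x∼c with a ≟ c
  ... | yes a≡c = a≡c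
  ... | no a≢c  = contradiction (a , c , a≢c , x∼a , x∼c) (λ br → ¬br (x , br))

  staysIn : ∀ {a c} → Walk G a c → a ≡ zero ⊎ a ≡ b → c ≡ zero ⊎ c ≡ b
  staysIn here              a∈ = a∈
  staysIn (step 0∼y walk) (inj₁ refl) = staysIn walk (inj₂ (unique 0∼y 0∼b))
  staysIn (step b∼y walk) (inj₂ refl) = staysIn walk (inj₁ (unique b∼y (∼-sym G 0∼b)))

  noThird : (∃ λ z → z ≢ zero × z ≢ b) → ∃ (Branching G)
  noThird (z , z≢0 , z≢b) with staysIn (conn zero z) (inj₁ refl)
  ... | inj₁ z≡0 = contradiction z≡0 z≢0
  ... | inj₂ z≡b = contradiction z≡b z≢b

LeafSupport : Graph n → Set
LeafSupport T = ∃₂ λ s t → s ∼[ T ] t × Branching T s × LeavesBesides T s t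

module _ (T : Graph n) (acyclic : Acyclic T) where

  module _ {L} (p : Path T (suc L)) where
    open Path p

    branchingNeighbour? : Dec (∃ λ c → vertex (suc L) ∼[ T ] c × c ≢ vertex L × Branching T c)
    branchingNeighbour? =
      any? λ c → (adj T (vertex (suc L)) c Bool.≟ true) ×-dec (¬? (c ≟ vertex L) ×-dec branching? T c)

    leafSupport-atEnd : Branching T (vertex (suc L)) →
      (∀ c → vertex (suc L) ∼[ T ] c → c ≢ vertex L → ¬ Branching T c) → LeafSupport T
    leafSupport-atEnd br leaves = vertex (suc L) , vertex L , ∼-sym T (edge ≤-refl) , br ,
      λ c s∼c c≢t → ¬branching⇒noNeighbourBut T (∼-sym T s∼c) (leaves c s∼c c≢t)

    extendOrClose : ∀ {c} → vertex (suc L) ∼[ T ] c → c ≢ vertex L →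
                    ∃ λ (q : Path T (2 + L)) → Path.vertex q (2 + L) ≡ c
    extendOrClose {c} s∼c c≢t with anyUpTo? (λ i → vertex i ≟ c) (2 + L)
    ... | no fresh = extend p s∼c (λ i≤ i↦c → fresh (_ , s≤s i≤ , i↦c)) , snoc-new p
    ... | yes (i , i<2+L , refl) =
      ⊥-elim (acyclic (backEdge⇒cycle p (s≤s (≤∧≢⇒< (s≤s⁻¹ i<1+L) (λ { refl → c≢t refl }))) s∼c))
      where
      i<1+L : i < suc L
      i<1+L = ≤∧≢⇒< (s≤s⁻¹ i<2+L) λ { refl → ∼⇒≢ T s∼c refl }

  -- Extend a path with branching end by a branching neighbour for as long as possible;
  -- acyclicity keeps it a path, so this stops, and the end vertex is then a leaf support.
  grow : ∀ fuel {L} (p : Path T (suc L)) → Branching T (Path.vertex p (suc L)) → n ≤ suc L + fuel →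
         LeafSupport T
  grow zero {L} p _ n≤1+L+0 =
    contradiction (≤-trans (path-length<order p) (≤-trans n≤1+L+0 (≤-reflexive (+-identityʳ (suc L)))))
                  1+n≰n
  grow (suc fuel) {L} p br n≤ with branchingNeighbour? p
  ... | no none = leafSupport-atEnd p br (λ c s∼c c≢t brc → none (c , s∼c , c≢t , brc))
  ... | yes (c , s∼c , c≢t , brc) with extendOrClose p s∼c c≢t
  ...   | q , q↦c =
    grow fuel q (subst (Branching T) (sym q↦c) brc) (≤-trans n≤ (≤-reflexive (+-suc (suc L) fuel)))

tree⇒leafSupport : (T : Graph (3 + n)) → IsTree T → LeafSupport T
tree⇒leafSupport T (connected , acyclic) with connected⇒branching T connected
... | x , br@(a , _ , _ , x∼a , _) = grow T acyclic _ (edgePath T x∼a) br (n≤1+n _)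

-- Deleting a leaf

≢⇒punchIn : {v w : Fin (suc n)} → w ≢ v → ∃ λ k → punchIn v k ≡ w
≢⇒punchIn w≢v = punchOut (λ v≡w → w≢v (sym v≡w)) , punchIn-punchOut _

module _ (T : Graph (suc n)) (v : Fin (suc n)) where
  private
    D : Graph n
    D = deleteVertex T v
    ↑ : Fin n → Fin (suc n)
    ↑ = punchIn v
    ↑≢v : ∀ y → ↑ y ≢ v
    ↑≢v = punchInᵢ≢i v
    ↑-injective : ∀ {y z} → ↑ y ≡ ↑ z → y ≡ z
    ↑-injective = punchIn-injective v _ _

  deleteVertex-acyclic : Acyclic T → Acyclic D
  deleteVertex-acyclic acyclic cycle = acyclic record
    { k = k ; len≥3 = len≥3 ; c = λ i → ↑ (c i)
    ; inj = λ eq → inj (↑-injective eq) ; edges = edges ; close = close }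
    where open Cycle cycle

  noNeighbourBut-deleteVertex : ∀ {i k} → (∀ y → y ≢ v → y ≢ ↑ k → adj T (↑ i) y ≡ false) →
                                NoNeighbourBut D i k
  noNeighbourBut-deleteVertex only y y≢k = only (↑ y) (↑≢v y) (λ eq → y≢k (↑-injective eq))

  inseparable-deleteVertex : ∀ {i k} → Inseparable T (↑ i) (↑ k) → Inseparable D i k
  inseparable-deleteVertex (x≢w , kind) = (λ i≡k → x≢w (cong ↑ i≡k)) , restrict kind
    where
    restrict : ∀ {i k} →
      NoNeighbourBut T (↑ i) (↑ k) ⊎ NoNeighbourBut T (↑ k) (↑ i) ⊎ SameNeighboursBesides T (↑ i) (↑ k) →
      NoNeighbourBut D i k ⊎ NoNeighbourBut D k i ⊎ SameNeighboursBesides D i k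
    restrict (inj₁ x⊆w)        = inj₁ (noNeighbourBut-deleteVertex (λ y _ → x⊆w y))
    restrict (inj₂ (inj₁ w⊆x)) = inj₂ (inj₁ (noNeighbourBut-deleteVertex (λ y _ → w⊆x y)))
    restrict (inj₂ (inj₂ same)) =
      inj₂ (inj₂ λ y y≢i y≢k → same (↑ y) (λ eq → y≢i (↑-injective eq)) (λ eq → y≢k (↑-injective eq)))

module _ (T : Graph (suc n)) {v s : Fin (suc n)} (v∼s : v ∼[ T ] s) (v⊆s : NoNeighbourBut T v s) where
  private
    D : Graph n
    D = deleteVertex T v
    ↑ : Fin n → Fin (suc n)
    ↑ = punchIn v

  leafNeighbour≡s : ∀ {y} → v ∼[ T ] y → y ≡ s
  leafNeighbour≡s {y} v∼y with y ≟ s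
  ... | yes y≡s = y≡s
  ... | no y≢s with trans (sym v∼y) (v⊆s y y≢s)
  ...   | ()

  pendant⇒isLeaf : IsLeaf T v
  pendant⇒isLeaf = trans (cong ∣_∣ N≡⁅s⁆) (∣⁅x⁆∣≡1 s)
    where
    N≡⁅s⁆ : N T v ≡ ⁅ s ⁆
    N≡⁅s⁆ = ⊆-antisym (λ y∈N → subst (_∈ ⁅ s ⁆) (sym (leafNeighbour≡s (∈N⁻ T y∈N))) (x∈⁅x⁆ s))
                      (λ y∈⁅s⁆ → subst (_∈ N T v) (sym (x∈⁅y⁆⇒x≡y s y∈⁅s⁆)) (∈N⁺ T v∼s))

  -- A walk in T between vertices other than v only enters v to come straight back to s.
  deleteLeaf-walk : ∀ {a b} → Walk T a b → ∀ {i j} → a ≡ ↑ i → b ≡ ↑ j → Walk D i j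
  deleteLeaf-walk here a≡i b≡j = subst (Walk D _) (punchIn-injective v _ _ (trans (sym a≡i) b≡j)) here
  deleteLeaf-walk (step {w = w} a∼w rest) {i} {j} a≡i b≡j with w ≟ v
  deleteLeaf-walk (step a∼v here) a≡i b≡j | yes refl = contradiction (sym b≡j) (punchInᵢ≢i v _)
  deleteLeaf-walk (step a∼v (step v∼w′ rest)) a≡i b≡j | yes refl =
    deleteLeaf-walk rest
      (trans (leafNeighbour≡s v∼w′) (trans (sym (leafNeighbour≡s (∼-sym T a∼v))) a≡i)) b≡j
  ... | no w≢v with ≢⇒punchIn w≢v
  ...   | k , k↦w =
    step (subst₂ (λ a w → a ∼[ T ] w) a≡i (sym k↦w) a∼w) (deleteLeaf-walk rest (sym k↦w) b≡j)

  deleteLeaf-connected : Connected T → Connected D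
  deleteLeaf-connected connected i j = deleteLeaf-walk (connected (↑ i) (↑ j)) refl refl

  -- If v is the partner of x ≠ s, then N(x) and N(v) agree outside {x, v}, so N(x) ⊆ {s, v}.
  deleteLeaf-allInseparable : NoIsolated T → AllInseparable T →
    (∀ j → ↑ j ≡ s → ∃ (Inseparable D j)) → AllInseparable D
  deleteLeaf-allInseparable nbr all atS i with ↑ i ≟ s
  ... | yes i↦s = atS i i↦s
  ... | no x≢s with all (↑ i)
  ...   | w , insep with w ≟ v
  ...     | no w≢v with ≢⇒punchIn w≢v
  ...       | k , k↦w = k , inseparable-deleteVertex T v (subst (Inseparable T (↑ i)) (sym k↦w) insep)
  deleteLeaf-allInseparable nbr all atS i | no x≢s | w , (_ , inj₁ x⊆v) | yes refl
    with nbr (↑ i)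
  ... | z , x∼z with z ≟ v
  ...   | yes refl = contradiction (leafNeighbour≡s (∼-sym T x∼z)) x≢s
  ...   | no z≢v with trans (sym x∼z) (x⊆v z z≢v)
  ...     | ()
  deleteLeaf-allInseparable nbr all atS i | no x≢s | w , (_ , inj₂ (inj₁ v⊆x)) | yes refl
    with trans (sym v∼s) (v⊆x s (λ s≡x → x≢s (sym s≡x)))
  ... | ()
  deleteLeaf-allInseparable nbr all atS i | no x≢s | w , (_ , inj₂ (inj₂ same)) | yes refl
    with ≢⇒punchIn (∼⇒≢ T v∼s ∘ sym)
  ... | k , k↦s = k , (λ i≡k → x≢s (trans (cong ↑ i≡k) k↦s)) , inj₁ (noNeighbourBut-deleteVertex T v x⊆s)
    where
    x⊆s : ∀ y → y ≢ v → y ≢ ↑ k → adj T (↑ i) y ≡ false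
    x⊆s y y≢v y≢k with y ≟ ↑ i
    ... | yes refl = irrefl T y
    ... | no y≢x = trans (same y y≢x y≢v) (v⊆s y (λ y≡s → y≢k (trans y≡s (sym k↦s))))

-- If s has a leaf u besides v, then u is a partner of s; otherwise N(s) ⊆ {t, v} and t is one.
supportPartner : (T : Graph (suc n)) {s t v : Fin (suc n)} → s ∼[ T ] t → LeavesBesides T s t → v ≢ t →
  ∀ j → punchIn v j ≡ s → ∃ (Inseparable (deleteVertex T v) j)
supportPartner T {s} {t} {v} s∼t leaves v≢t j j↦s
  with any? (λ u → (adj T s u Bool.≟ true) ×-dec (¬? (u ≟ t) ×-dec ¬? (u ≟ v)))
... | yes (u , s∼u , u≢t , u≢v) with ≢⇒punchIn u≢v
...   | k , k↦u =
  k , (λ { refl → ∼⇒≢ T s∼u (trans (sym j↦s) k↦u) }) ,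
  inj₂ (inj₁ (noNeighbourBut-deleteVertex T v λ y _ y≢j →
    subst (λ x → adj T x y ≡ false) (sym k↦u) (leaves u s∼u u≢t y (λ { refl → y≢j (sym j↦s) }))))
supportPartner T {s} {t} {v} s∼t leaves v≢t j j↦s | no noThird with ≢⇒punchIn (v≢t ∘ sym)
... | k , k↦t =
  k , (λ { refl → ∼⇒≢ T s∼t (trans (sym j↦s) k↦t) }) , inj₁ (noNeighbourBut-deleteVertex T v s⊆tv)
  where
  s⊆tv : ∀ y → y ≢ v → y ≢ punchIn v k → adj T (punchIn v j) y ≡ false
  s⊆tv y y≢v y≢k rewrite j↦s with adj T s y in s∼y
  ... | false = refl
  ... | true  = contradiction (y , s∼y , (λ y≡t → y≢k (trans y≡t (sym k↦t))) , y≢v) noThird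

leafSupport⇒deletableLeaf : (T : Graph (suc n)) → LeafSupport T →
  ∃₂ λ v s → v ∼[ T ] s × NoNeighbourBut T v s ×
             (∀ j → punchIn v j ≡ s → ∃ (Inseparable (deleteVertex T v) j))
leafSupport⇒deletableLeaf T (s , t , s∼t , (a , b , a≢b , s∼a , s∼b) , leaves) with a ≟ t
... | yes refl = b , s , ∼-sym T s∼b , leaves b s∼b (a≢b ∘ sym) , supportPartner T s∼t leaves (a≢b ∘ sym)
... | no a≢t   = a , s , ∼-sym T s∼a , leaves a s∼a a≢t , supportPartner T s∼t leaves a≢t

deleteLeaf-inTmax : (T : Graph (3 + n)) {v s : Fin (3 + n)} → IsTree T → REDLDNumber T (3 + n) →
  v ∼[ T ] s → NoNeighbourBut T v s → (∀ j → punchIn v j ≡ s → ∃ (Inseparable (deleteVertex T v) j)) →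
  InTmax (deleteVertex T v)
deleteLeaf-inTmax T {v} (connected , acyclic) redld v∼s v⊆s partner =
  s≤s (s≤s z≤n) , (connectedD , deleteVertex-acyclic T v acyclic) ,
  allInseparable⇒redldNumber (deleteVertex T v) (connected⇒noIsolated (deleteVertex T v) connectedD)
    (deleteLeaf-allInseparable T v∼s v⊆s nbr (redldNumber⇒allInseparable T nbr redld) partner)
  where
  nbr : NoIsolated T
  nbr = connected⇒noIsolated T connected
  connectedD : Connected (deleteVertex T v)
  connectedD = deleteLeaf-connected T v∼s v⊆s connected

theorem12 : ∀ {n} (T : Graph (suc n)) → 3 ≤ suc n → InTmax T →
    ∃ λ v → IsLeaf T v × InTmax (deleteVertex T v)
theorem12 {zero}        T (s≤s ()) _
theorem12 {suc zero}    T (s≤s (s≤s ())) _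
theorem12 {suc (suc _)} T _ (_ , tree , redld) =
  let v , s , v∼s , v⊆s , partner = leafSupport⇒deletableLeaf T (tree⇒leafSupport T tree)
  in v , pendant⇒isLeaf T v∼s v⊆s , deleteLeaf-inTmax T tree redld v∼s v⊆s partner
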